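{- Let $k$ be a positive integer such that there exists an odd integer $u\ge1$ for which the $u+1$ least significant binary digits of $k$ (read from most to least significant) form the word $0\,1^u$, i.e. $L_{u+1}(k)=01^u$. Then $f(k)\le k$. Furthermore, $f(k)=k$ if and only if $k=2^r+1$ for some integer $r\ge2$.
   Context: $s_2(n)$ is the binary sum of digits of $n\ge0$, $t_n=s_2(n)\bmod 2$, and $f(k)=\min\{n\ge0: t_{kn}=1\}$ for $k\ge1$. If $k=\sum_{i=0}^{\ell-1}\varepsilon_i 2^i$ with $\varepsilon_i\in\{0,1\}$, $\varepsilon_{\ell-1}=1$, then $\ell=\ell(k)$ is the binary length, and for $1\le j\le \ell(k)$, $L_j(k)$ is the word $\varepsilon_{j-1}\cdots\varepsilon_0$ of the $j$ least significant digits (use of $L_j(k)$ presupposes $\ell(k)\ge j$). For $a\in\{0,1\}$, $a^n$ denotes the word consisting of $n$ copies of $a$; juxtaposition denotes concatenation. -}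

module Defs where

open import Data.Nat using (ℕ; zero; suc; _+_; _*_; _^_; _≤_; _<_; _/_; _%_)
open import Data.Nat.Properties using ()
open import Data.List using (List; []; _∷_; _++_; replicate)
open import Data.Product using (_×_)
open import Relation.Binary.PropositionalEquality using (_≡_)

s₂-fuel : ℕ → ℕ → ℕ
s₂-fuel zero    n = 0
s₂-fuel (suc f) n = n % 2 + s₂-fuel f (n / 2)

-- n / 2 ^ n = 0, so fuel n suffices
s₂ : ℕ → ℕ
s₂ n = s₂-fuel n n

t : ℕ → ℕ
t n = s₂ n % 2

digit : ℕ → ℕ → ℕ
digit k zero    = k % 2
digit k (suc i) = digit (k / 2) i

-- binary length ℓ(k) ≥ j  iff  2^(j-1) ≤ k, i.e. 2^j ≤ 2k
LengthAtLeast : ℕ → ℕ → Set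
LengthAtLeast k j = 2 ^ j ≤ 2 * k

lowDigits : ℕ → ℕ → List ℕ
lowDigits k zero    = []
lowDigits k (suc j) = digit k j ∷ lowDigits k j

-- L_j(k) = w, with the presupposition ℓ(k) ≥ j
L≡ : ℕ → ℕ → List ℕ → Set
L≡ j k w = LengthAtLeast k j × lowDigits k j ≡ w

IsF : ℕ → ℕ → Set
IsF k m = t (k * m) ≡ 1 × (∀ n → n < m → t (k * n) ≡ 0)

-- Write k = 2ʲ + c where c < 2ʲ has binary expansion e 0 1ᵘ.  Since
-- k (2ʲ + 1) = (2ʲ + c + 1) 2ʲ + c concatenates the binary words of 2ʲ + c + 1 and c, its digit sum is
-- 1 + s₂(c + 1) + s₂(c) = 1 + (1 + s₂ e) + (s₂ e + u), which is odd for odd u.  So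
-- f(k) ≤ 2ʲ + 1 ≤ k, with equality only if c = 1.  Conversely, for k = 2ʳ + 1 and n ≤ 2ʳ
-- the digit sum of k n is 2 s₂(n) (if n < 2ʳ) or 2 (if n = 2ʳ), so f(k) = k.
module Submission where

open import Defs
open import Data.Nat using (ℕ; zero; suc; _+_; _*_; _^_; _≤_; _<_; _≥_; _%_; _/_; z≤n; s≤s)
open import Data.Nat.Properties
open import Data.Nat.DivMod
open import Data.Nat.Divisibility using (divides-refl)
open import Data.Nat.Tactic.RingSolver using (solve-∀)
open import Data.List using (_∷_; _∷ʳ_; replicate)
open import Data.List.Properties using (∷-injectiveˡ; ∷ʳ-injective)
open import Data.Product using (_×_; _,_; ∃-syntax)
open import Data.Sum using (inj₁; inj₂)
open import Function.Bundles using (_⇔_; mk⇔)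
open import Relation.Nullary using (¬_; yes; no; contradiction)
open import Relation.Unary using (Decidable)
open import Relation.Binary.PropositionalEquality

s₂-fuel-zero : ∀ f → s₂-fuel f 0 ≡ 0
s₂-fuel-zero zero    = refl
s₂-fuel-zero (suc f) = s₂-fuel-zero f

n≤1+f⇒n/2≤f : ∀ {n f} → n ≤ suc f → n / 2 ≤ f
n≤1+f⇒n/2≤f {f = zero}  n≤1   = ≤-trans (/-monoˡ-≤ 2 n≤1) z≤n
n≤1+f⇒n/2≤f {f = suc f} n≤2+f = ≤-trans (/-monoˡ-≤ 2 n≤2+f) (m<1+n⇒m≤n (m/n<m (suc (suc f)) 2 ≤-refl))

s₂-fuel-irrelevant : ∀ f g n → n ≤ f → n ≤ g → s₂-fuel f n ≡ s₂-fuel g n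
s₂-fuel-irrelevant zero    zero    n       _   _   = refl
s₂-fuel-irrelevant zero    (suc g) .zero   z≤n _   = sym (s₂-fuel-zero g)
s₂-fuel-irrelevant (suc f) zero    .zero   _   z≤n = s₂-fuel-zero f
s₂-fuel-irrelevant (suc f) (suc g) n       n≤1+f n≤1+g =
  cong (n % 2 +_) (s₂-fuel-irrelevant f g (n / 2) (n≤1+f⇒n/2≤f n≤1+f) (n≤1+f⇒n/2≤f n≤1+g))

s₂-unfold : ∀ n → s₂ n ≡ n % 2 + s₂ (n / 2)
s₂-unfold zero    = refl
s₂-unfold (suc n) =
  cong (suc n % 2 +_) (s₂-fuel-irrelevant n (suc n / 2) (suc n / 2) (n≤1+f⇒n/2≤f ≤-refl) ≤-refl)

s₂-bit : ∀ b n → b < 2 → s₂ (b + n * 2) ≡ b + s₂ n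
s₂-bit b n b<2 = begin
  s₂ (b + n * 2)                          ≡⟨ s₂-unfold (b + n * 2) ⟩
  (b + n * 2) % 2 + s₂ ((b + n * 2) / 2)  ≡⟨ cong₂ _+_ low (cong s₂ high) ⟩
  b + s₂ n                                ∎
  where
  open ≡-Reasoning
  low : (b + n * 2) % 2 ≡ b
  low = trans ([m+kn]%n≡m%n b n 2) (m<n⇒m%n≡m b<2)
  high : (b + n * 2) / 2 ≡ n
  high = begin
    (b + n * 2) / 2    ≡⟨ +-distrib-/-∣ʳ b (divides-refl n) ⟩
    b / 2 + n * 2 / 2  ≡⟨ cong₂ _+_ (m<n⇒m/n≡0 b<2) (m*n/n≡m n 2) ⟩
    n                  ∎

s₂-concat : ∀ j a b → b < 2 ^ j → s₂ (a * 2 ^ j + b) ≡ s₂ a + s₂ b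
s₂-concat zero    a zero (s≤s z≤n) =
  trans (cong s₂ (trans (+-identityʳ (a * 1)) (*-identityʳ a))) (sym (+-identityʳ (s₂ a)))
s₂-concat (suc j) a b b<2^1+j = begin
  s₂ (a * (2 * 2 ^ j) + b)                  ≡⟨ cong s₂ shift ⟩
  s₂ (b % 2 + (a * 2 ^ j + b / 2) * 2)      ≡⟨ s₂-bit (b % 2) (a * 2 ^ j + b / 2) (m%n<n b 2) ⟩
  b % 2 + s₂ (a * 2 ^ j + b / 2)            ≡⟨ cong (b % 2 +_) (s₂-concat j a (b / 2) b/2<2^j) ⟩
  b % 2 + (s₂ a + s₂ (b / 2))               ≡⟨ x+[y+z]≡y+[x+z] (b % 2) (s₂ a) (s₂ (b / 2)) ⟩
  s₂ a + (b % 2 + s₂ (b / 2))               ≡⟨ cong (s₂ a +_) (sym (s₂-bit (b % 2) (b / 2) (m%n<n b 2))) ⟩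
  s₂ a + s₂ (b % 2 + b / 2 * 2)             ≡⟨ cong (λ x → s₂ a + s₂ x) (sym (m≡m%n+[m/n]*n b 2)) ⟩
  s₂ a + s₂ b                               ∎
  where
  open ≡-Reasoning
  x+[y+z]≡y+[x+z] : ∀ x y z → x + (y + z) ≡ y + (x + z)
  x+[y+z]≡y+[x+z] = solve-∀
  regroup : ∀ a p r h → a * (2 * p) + (r + h * 2) ≡ r + (a * p + h) * 2
  regroup = solve-∀
  shift : a * (2 * 2 ^ j) + b ≡ b % 2 + (a * 2 ^ j + b / 2) * 2
  shift = begin
    a * (2 * 2 ^ j) + b                  ≡⟨ cong (a * (2 * 2 ^ j) +_) (m≡m%n+[m/n]*n b 2) ⟩
    a * (2 * 2 ^ j) + (b % 2 + b / 2 * 2) ≡⟨ regroup a (2 ^ j) (b % 2) (b / 2) ⟩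
    b % 2 + (a * 2 ^ j + b / 2) * 2      ∎
  b/2<2^j : b / 2 < 2 ^ j
  b/2<2^j = m<n*o⇒m/o<n (subst (b <_) (*-comm 2 (2 ^ j)) b<2^1+j)

s₂-*2^ : ∀ j a → s₂ (a * 2 ^ j) ≡ s₂ a
s₂-*2^ j a = begin
  s₂ (a * 2 ^ j)      ≡⟨ cong s₂ (sym (+-identityʳ (a * 2 ^ j))) ⟩
  s₂ (a * 2 ^ j + 0)  ≡⟨ s₂-concat j a 0 (m^n>0 2 j) ⟩
  s₂ a + 0            ≡⟨ +-identityʳ (s₂ a) ⟩
  s₂ a                ∎
  where open ≡-Reasoning

s₂-2^+ : ∀ j b → b < 2 ^ j → s₂ (2 ^ j + b) ≡ suc (s₂ b)
s₂-2^+ j b b<2^j = begin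
  s₂ (2 ^ j + b)      ≡⟨ cong (λ x → s₂ (x + b)) (sym (*-identityˡ (2 ^ j))) ⟩
  s₂ (1 * 2 ^ j + b)  ≡⟨ s₂-concat j 1 b b<2^j ⟩
  suc (s₂ b)          ∎
  where open ≡-Reasoning

ones : ℕ → ℕ
ones zero    = 0
ones (suc j) = 1 + ones j * 2

s₂-ones : ∀ j → s₂ (ones j) ≡ j
s₂-ones zero    = refl
s₂-ones (suc j) = trans (s₂-bit 1 (ones j) ≤-refl) (cong suc (s₂-ones j))

suc-ones : ∀ j → suc (ones j) ≡ 2 ^ j
suc-ones zero    = refl
suc-ones (suc j) = begin
  suc (1 + ones j * 2)  ≡⟨ cong (_* 2) (suc-ones j) ⟩
  2 ^ j * 2             ≡⟨ *-comm (2 ^ j) 2 ⟩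
  2 * 2 ^ j             ∎
  where open ≡-Reasoning

ones<2^1+ : ∀ j → ones j < 2 ^ suc j
ones<2^1+ j = begin-strict
  ones j         <⟨ n<1+n (ones j) ⟩
  suc (ones j)   ≡⟨ suc-ones j ⟩
  2 ^ j          ≤⟨ m≤m+n (2 ^ j) (2 ^ j + 0) ⟩
  2 ^ suc j      ∎
  where open ≤-Reasoning

-- e ·01^ u has binary expansion (e) 0 1ᵘ.
infix 8 _·01^_
_·01^_ : ℕ → ℕ → ℕ
e ·01^ u = e * 2 ^ suc u + ones u

s₂-·01^ : ∀ e u → s₂ (e ·01^ u) ≡ s₂ e + u
s₂-·01^ e u = trans (s₂-concat (suc u) e (ones u) (ones<2^1+ u)) (cong (s₂ e +_) (s₂-ones u))

suc-·01^ : ∀ e u → suc (e ·01^ u) ≡ (1 + e * 2) * 2 ^ u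
suc-·01^ e u = begin
  suc (e * (2 * 2 ^ u) + ones u)  ≡⟨ +-suc (e * (2 * 2 ^ u)) (ones u) ⟨
  e * (2 * 2 ^ u) + suc (ones u)  ≡⟨ cong (e * (2 * 2 ^ u) +_) (suc-ones u) ⟩
  e * (2 * 2 ^ u) + 2 ^ u         ≡⟨ regroup e (2 ^ u) ⟩
  (1 + e * 2) * 2 ^ u             ∎
  where
  open ≡-Reasoning
  regroup : ∀ e p → e * (2 * p) + p ≡ (1 + e * 2) * p
  regroup = solve-∀

s₂-suc-·01^ : ∀ e u → s₂ (suc (e ·01^ u)) ≡ suc (s₂ e)
s₂-suc-·01^ e u = begin
  s₂ (suc (e ·01^ u))        ≡⟨ cong s₂ (suc-·01^ e u) ⟩
  s₂ ((1 + e * 2) * 2 ^ u)   ≡⟨ s₂-*2^ u (1 + e * 2) ⟩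
  s₂ (1 + e * 2)             ≡⟨ s₂-bit 1 e ≤-refl ⟩
  suc (s₂ e)                 ∎
  where open ≡-Reasoning

suc-·01^<2^ : ∀ {e} q u → e < 2 ^ q → suc (e ·01^ u) < 2 ^ (q + suc u)
suc-·01^<2^ {e} q u e<2^q = begin-strict
  suc (e ·01^ u)         ≡⟨ suc-·01^ e u ⟩
  (1 + e * 2) * 2 ^ u    <⟨ *-monoˡ-< (2 ^ u) {{m^n≢0 2 u}} (*-monoˡ-≤ 2 e<2^q) ⟩
  2 ^ q * 2 * 2 ^ u      ≡⟨ cong (_* 2 ^ u) (*-comm (2 ^ q) 2) ⟩
  2 ^ suc q * 2 ^ u      ≡⟨ ^-distribˡ-+-* 2 (suc q) u ⟨
  2 ^ (suc q + u)        ≡⟨ cong (2 ^_) (+-suc q u) ⟨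
  2 ^ (q + suc u)        ∎
  where open ≤-Reasoning

·01^-split : ∀ q e u → (2 ^ q + e) ·01^ u ≡ 2 ^ (q + suc u) + e ·01^ u
·01^-split q e u = begin
  (2 ^ q + e) * 2 ^ suc u + ones u        ≡⟨ regroup (2 ^ q) e (2 ^ suc u) (ones u) ⟩
  2 ^ q * 2 ^ suc u + e ·01^ u            ≡⟨ cong (_+ e ·01^ u) (^-distribˡ-+-* 2 q (suc u)) ⟨
  2 ^ (q + suc u) + e ·01^ u              ∎
  where
  open ≡-Reasoning
  regroup : ∀ p e b o → (p + e) * b + o ≡ p * b + (e * b + o)
  regroup = solve-∀

·01^-pos : ∀ e {u} → 1 ≤ u → 1 ≤ e ·01^ u
·01^-pos e {suc u} _ = ≤-trans (s≤s z≤n) (m≤n+m (ones (suc u)) (e * 2 ^ suc (suc u)))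

lowDigits-snoc : ∀ j k → lowDigits k (suc j) ≡ lowDigits (k / 2) j ∷ʳ k % 2
lowDigits-snoc zero    k = refl
lowDigits-snoc (suc j) k = cong (digit (k / 2) j ∷_) (lowDigits-snoc j k)

replicate-snoc : ∀ j (x : ℕ) → replicate (suc j) x ≡ replicate j x ∷ʳ x
replicate-snoc zero    x = refl
replicate-snoc (suc j) x = cong (x ∷_) (replicate-snoc j x)

lowDigits≡01^⇒ : ∀ j k → lowDigits k (suc j) ≡ 0 ∷ replicate j 1 → ∃[ d ] k ≡ d ·01^ j
lowDigits≡01^⇒ zero k digits = k / 2 , (begin
  k                  ≡⟨ m≡m%n+[m/n]*n k 2 ⟩
  k % 2 + k / 2 * 2  ≡⟨ cong (_+ k / 2 * 2) (∷-injectiveˡ digits) ⟩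
  k / 2 * 2          ≡⟨ +-identityʳ (k / 2 * 2) ⟨
  (k / 2) ·01^ 0     ∎)
  where open ≡-Reasoning
lowDigits≡01^⇒ (suc j) k digits
  with high , low ← ∷ʳ-injective (lowDigits (k / 2) (suc j)) (0 ∷ replicate j 1)
         (trans (sym (lowDigits-snoc (suc j) k)) (trans digits (cong (0 ∷_) (replicate-snoc j 1))))
  with d , k/2≡ ← lowDigits≡01^⇒ j (k / 2) high
  = d , (begin
    k                              ≡⟨ m≡m%n+[m/n]*n k 2 ⟩
    k % 2 + k / 2 * 2              ≡⟨ cong₂ (λ b h → b + h * 2) low k/2≡ ⟩
    1 + (d ·01^ j) * 2             ≡⟨ regroup d (2 ^ j) (ones j) ⟩
    d ·01^ suc j                   ∎)
  where
  open ≡-Reasoning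
  regroup : ∀ d p o → 1 + (d * (2 * p) + o) * 2 ≡ d * (2 * (2 * p)) + (1 + o * 2)
  regroup = solve-∀

L≡01^⇒ : ∀ {k} u → L≡ (u + 1) k (0 ∷ replicate u 1) → ∃[ d ] k ≡ suc d ·01^ u
L≡01^⇒ {k} u (long , digits)
  with lowDigits≡01^⇒ u k (subst (λ j → lowDigits k j ≡ 0 ∷ replicate u 1) (+-comm u 1) digits)
... | suc d , k≡ = d , k≡
... | zero  , refl = contradiction long (<⇒≱ (begin-strict
  2 * ones u        <⟨ *-monoʳ-< 2 (n<1+n (ones u)) ⟩
  2 * suc (ones u)  ≡⟨ cong (2 *_) (suc-ones u) ⟩
  2 ^ suc u         ≡⟨ cong (2 ^_) (+-comm 1 u) ⟩
  2 ^ (u + 1)       ∎))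
  where open ≤-Reasoning

leadingPower : ∀ d → ∃[ q ] ∃[ e ] (e < 2 ^ q × suc d ≡ 2 ^ q + e)
leadingPower zero = 0 , 0 , s≤s z≤n , refl
leadingPower (suc d) with q , e , e<2^q , d≡ ← leadingPower d with m≤n⇒m<n∨m≡n e<2^q
... | inj₁ 1+e<2^q = q , suc e , 1+e<2^q , trans (cong suc d≡) (sym (+-suc (2 ^ q) e))
... | inj₂ 1+e≡2^q = suc q , 0 , m^n>0 2 (suc q) , (begin
  suc (suc d)      ≡⟨ cong suc d≡ ⟩
  suc (2 ^ q + e)  ≡⟨ +-suc (2 ^ q) e ⟨
  2 ^ q + suc e    ≡⟨ cong (2 ^ q +_) 1+e≡2^q ⟩
  2 ^ q + 2 ^ q    ≡⟨ cong (2 ^ q +_) (+-identityʳ (2 ^ q)) ⟨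
  2 ^ suc q        ≡⟨ +-identityʳ (2 ^ suc q) ⟨
  2 ^ suc q + 0    ∎)
  where open ≡-Reasoning

t≡%2 : ∀ n r m → s₂ n ≡ r + m * 2 → t n ≡ r % 2
t≡%2 n r m s₂n≡ = trans (cong (_% 2) s₂n≡) ([m+kn]%n≡m%n r m 2)

t≢1⇒t≡0 : ∀ n → t n ≢ 1 → t n ≡ 0
t≢1⇒t≡0 n t≢1 with t n | m%n<n (s₂ n) 2
... | 0 | _ = refl
... | 1 | _ = contradiction refl t≢1
... | suc (suc _) | s≤s (s≤s ())

s₂-[2^j+c]*[2^j+1] : ∀ j c → suc c < 2 ^ j → s₂ ((2 ^ j + c) * (2 ^ j + 1)) ≡ suc (s₂ (suc c) + s₂ c)
s₂-[2^j+c]*[2^j+1] j c 1+c<2^j = begin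
  s₂ ((2 ^ j + c) * (2 ^ j + 1))        ≡⟨ cong s₂ (regroup (2 ^ j) c) ⟩
  s₂ ((2 ^ j + suc c) * 2 ^ j + c)      ≡⟨ s₂-concat j (2 ^ j + suc c) c (<-trans (n<1+n c) 1+c<2^j) ⟩
  s₂ (2 ^ j + suc c) + s₂ c             ≡⟨ cong (_+ s₂ c) (s₂-2^+ j (suc c) 1+c<2^j) ⟩
  suc (s₂ (suc c) + s₂ c)               ∎
  where
  open ≡-Reasoning
  regroup : ∀ p c → (p + c) * (p + 1) ≡ (p + suc c) * p + c
  regroup = solve-∀

t-witness : ∀ e q u → u % 2 ≡ 1 → e < 2 ^ q →
            t ((2 ^ (q + suc u) + e ·01^ u) * (2 ^ (q + suc u) + 1)) ≡ 1
t-witness e q u u-odd e<2^q = trans (t≡%2 ((2 ^ (q + suc u) + e ·01^ u) * (2 ^ (q + suc u) + 1)) u (suc (s₂ e)) s₂≡) u-odd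
  where
  open ≡-Reasoning
  c = e ·01^ u
  regroup : ∀ s u → suc (suc s + (s + u)) ≡ u + suc s * 2
  regroup = solve-∀
  s₂≡ : s₂ ((2 ^ (q + suc u) + c) * (2 ^ (q + suc u) + 1)) ≡ u + suc (s₂ e) * 2
  s₂≡ = begin
    s₂ ((2 ^ (q + suc u) + c) * (2 ^ (q + suc u) + 1))  ≡⟨ s₂-[2^j+c]*[2^j+1] (q + suc u) c (suc-·01^<2^ q u e<2^q) ⟩
    suc (s₂ (suc c) + s₂ c)                             ≡⟨ cong₂ (λ x y → suc (x + y)) (s₂-suc-·01^ e u) (s₂-·01^ e u) ⟩
    suc (suc (s₂ e) + (s₂ e + u))                       ≡⟨ regroup (s₂ e) u ⟩
    u + suc (s₂ e) * 2                                  ∎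

t-[2^r+1]*n≡0 : ∀ r n → 1 ≤ r → n ≤ 2 ^ r → t ((2 ^ r + 1) * n) ≡ 0
t-[2^r+1]*n≡0 r n 1≤r n≤2^r with m≤n⇒m<n∨m≡n n≤2^r
... | inj₁ n<2^r = t≡%2 ((2 ^ r + 1) * n) 0 (s₂ n) (begin
  s₂ ((2 ^ r + 1) * n)  ≡⟨ cong s₂ (regroup (2 ^ r) n) ⟩
  s₂ (n * 2 ^ r + n)    ≡⟨ s₂-concat r n n n<2^r ⟩
  s₂ n + s₂ n           ≡⟨ double (s₂ n) ⟩
  s₂ n * 2              ∎)
  where
  open ≡-Reasoning
  regroup : ∀ p n → (p + 1) * n ≡ n * p + n
  regroup = solve-∀
  double : ∀ x → x + x ≡ x * 2
  double = solve-∀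
... | inj₂ refl = t≡%2 ((2 ^ r + 1) * 2 ^ r) 0 1 (begin
  s₂ ((2 ^ r + 1) * 2 ^ r)  ≡⟨ s₂-*2^ r (2 ^ r + 1) ⟩
  s₂ (2 ^ r + 1)            ≡⟨ s₂-2^+ r 1 (^-monoʳ-< 2 ≤-refl 1≤r) ⟩
  2                         ∎)
  where open ≡-Reasoning

least-≤ : ∀ {P : ℕ → Set} → Decidable P → ∀ b {n} → n ≤ b → P n →
          ∃[ m ] (P m × m ≤ n × (∀ {i} → i < m → ¬ P i))
least-≤ P? zero    z≤n P0 = 0 , P0 , z≤n , λ ()
least-≤ P? (suc b) {n} n≤1+b Pn with anyUpTo? P? n
... | no none = n , Pn , ≤-refl , λ i<n Pi → none (_ , i<n , Pi)
... | yes (i , i<n , Pi) with m , Pm , m≤i , below ← least-≤ P? b (m<1+n⇒m≤n (≤-trans i<n n≤1+b)) Pi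
  = m , Pm , ≤-trans m≤i (<⇒≤ i<n) , below

f-exists : ∀ k {n} → t (k * n) ≡ 1 → ∃[ m ] (IsF k m × m ≤ n)
f-exists k {n} tkn≡1 with m , tkm≡1 , m≤n , below ← least-≤ (λ i → t (k * i) ≟ 1) n ≤-refl tkn≡1
  = m , (tkm≡1 , λ i i<m → t≢1⇒t≡0 (k * i) (below i<m)) , m≤n

2^r+1≤f : ∀ {r m} → 1 ≤ r → IsF (2 ^ r + 1) m → 2 ^ r + 1 ≤ m
2^r+1≤f {r} {m} 1≤r (tkm≡1 , _) = ≮⇒≥ λ m<2^r+1 →
  0≢1+n (trans (sym (t-[2^r+1]*n≡0 r m 1≤r (m<1+n⇒m≤n (subst (m <_) (+-comm (2 ^ r) 1) m<2^r+1)))) tkm≡1)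

f-bound : ∀ {k} j c → 2 ≤ j → 1 ≤ c → k ≡ 2 ^ j + c → t ((2 ^ j + c) * (2 ^ j + 1)) ≡ 1 →
          ∃[ m ] (IsF k m × m ≤ k × (m ≡ k ⇔ (∃[ r ] (r ≥ 2 × k ≡ 2 ^ r + 1))))
f-bound j c 2≤j 1≤c refl tkn₀≡1 with m , isF , m≤n₀ ← f-exists (2 ^ j + c) tkn₀≡1 =
  m , isF , m≤k , mk⇔ sharp unsharp
  where
  k = 2 ^ j + c
  n₀≤k : 2 ^ j + 1 ≤ k
  n₀≤k = +-monoʳ-≤ (2 ^ j) 1≤c
  m≤k : m ≤ k
  m≤k = ≤-trans m≤n₀ n₀≤k
  sharp : m ≡ k → ∃[ r ] (r ≥ 2 × k ≡ 2 ^ r + 1)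
  sharp m≡k = j , 2≤j , ≤-antisym (subst (_≤ 2 ^ j + 1) m≡k m≤n₀) n₀≤k
  unsharp : ∃[ r ] (r ≥ 2 × k ≡ 2 ^ r + 1) → m ≡ k
  unsharp (r , r≥2 , k≡2^r+1) = ≤-antisym m≤k
    (subst (_≤ m) (sym k≡2^r+1) (2^r+1≤f (≤-trans (s≤s z≤n) r≥2) (subst (λ k → IsF k m) k≡2^r+1 isF)))

lemma1 : ∀ (k u : ℕ) → k ≥ 1 → u ≥ 1 → u % 2 ≡ 1 → L≡ (u + 1) k (0 ∷ replicate u 1) →
    ∃[ m ] (IsF k m × m ≤ k × (m ≡ k ⇔ (∃[ r ] (r ≥ 2 × k ≡ 2 ^ r + 1))))
lemma1 k u _ u≥1 u-odd digits
  with d , k≡1+d·01^u ← L≡01^⇒ u digits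
  with q , e , e<2^q , 1+d≡2^q+e ← leadingPower d
  = f-bound (q + suc u) (e ·01^ u)
      (≤-trans (s≤s u≥1) (m≤n+m (suc u) q))
      (·01^-pos e u≥1)
      (trans k≡1+d·01^u (trans (cong (_·01^ u) 1+d≡2^q+e) (·01^-split q e u)))
      (t-witness e q u u-odd e<2^q)
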